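{- Let $n\ge 3$ be odd. The randomized protocol RandomHalfInConcert$_n$ has worst-case expected cost exactly $\frac{n+1}{2}$.
   Context: Two agents sit at two distinct sites among $V=\{0,\ldots,n-1\}$ and search for each other by queries "is there an agent at site $j$?"; the execution ends at the first query made by one agent to the site of the other. Protocol RandomHalfInConcert$_n$ ($n$ odd, $m=(n-1)/2$): an agent at site $i$ has target set $S_i=\{(i+1)\bmod n,\ldots,(i+m)\bmod n\}$ and independently chooses a uniformly random ordering $s_{i,1},\ldots,s_{i,m}$ of $S_i$. Querying proceeds in rounds $r=1,2,\ldots,m$; within round $r$, the sites $0,1,\ldots,n-1$ take turns in increasing order, and each site occupied by an agent queries $s_{i,r}$. The cost of an execution is the total number of queries made by both agents up to and including the first successful query. The worst-case expected cost is the maximum, over all placements of the two agents, of the expected cost (expectation over the agents' random orderings). -}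

module Defs where

open import Data.Nat using (ℕ; zero; suc; _+_; _*_; _%_; _/_; _≡ᵇ_)
open import Data.Bool using (Bool; true; false; if_then_else_; _∧_; _∨_)
open import Data.List using (List; []; _∷_; _++_; map; concatMap; upTo; length)
open import Data.Nat.ListAction using (sum)
open import Data.Maybe using (Maybe; just; nothing)
open import Data.Product using (_×_; _,_)
open import Data.Fin using (Fin; toℕ)
open import Data.Integer using (+_)
import Data.Rational as ℚ
open ℚ using (ℚ)

-- m = (n - 1) / 2 (for odd n this is floor (n / 2))
half : ℕ → ℕ
half n = n / 2

targetSet : (n i : ℕ) → List ℕ
targetSet n@(suc _) i = map (λ k → (i + k) % n) (map suc (upTo (half n)))
targetSet zero i = []

insertions : ℕ → List ℕ → List (List ℕ)
insertions x [] = (x ∷ []) ∷ []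
insertions x (y ∷ ys) = (x ∷ y ∷ ys) ∷ map (y ∷_) (insertions x ys)

-- all orderings (permutations) of a list; for a list of distinct elements
-- every ordering occurs exactly once
orderings : List ℕ → List (List ℕ)
orderings [] = [] ∷ []
orderings (x ∷ xs) = concatMap (insertions x) (orderings xs)

nth : List ℕ → ℕ → Maybe ℕ
nth [] _ = nothing
nth (x ∷ xs) zero = just x
nth (x ∷ xs) (suc r) = nth xs r

-- a query (querying site , queried site)
Query : Set
Query = ℕ × ℕ

query : ℕ → Maybe ℕ → List Query
query i (just t) = (i , t) ∷ []
query i nothing = []

-- Round r (0-based, i.e. paper's round r+1): sites 0..n-1 in increasing order,
-- each occupied site i queries its (r+1)-st target.
roundQueries : (n a b : ℕ) (σa σb : List ℕ) (r : ℕ) → List Query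
roundQueries n a b σa σb r =
  concatMap (λ j → if j ≡ᵇ a then query a (nth σa r)
                   else if j ≡ᵇ b then query b (nth σb r) else [])
            (upTo n)

allQueries : (n a b : ℕ) (σa σb : List ℕ) → List Query
allQueries n a b σa σb = concatMap (roundQueries n a b σa σb) (upTo (half n))

success : (a b : ℕ) → Query → Bool
success a b (i , t) = ((i ≡ᵇ a) ∧ (t ≡ᵇ b)) ∨ ((i ≡ᵇ b) ∧ (t ≡ᵇ a))

costUntil : (a b : ℕ) → List Query → ℕ
costUntil a b [] = 0
costUntil a b (q ∷ qs) = if success a b q then 1 else suc (costUntil a b qs)

cost : (n a b : ℕ) (σa σb : List ℕ) → ℕ
cost n a b σa σb = costUntil a b (allQueries n a b σa σb)

average : List ℕ → ℚ
average [] = ℚ.0ℚ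
average xs@(_ ∷ ys) = (+ sum xs) ℚ./ suc (length ys)

-- expected cost for agents placed at sites a and b: average over all pairs
-- of independent uniformly random orderings of S_a and S_b
expectedCost : (n : ℕ) (a b : Fin n) → ℚ
expectedCost n a b =
  average (concatMap (λ σa → map (λ σb → cost n (toℕ a) (toℕ b) σa σb)
                                 (orderings (targetSet n (toℕ b))))
                     (orderings (targetSet n (toℕ a))))

module Submission where

-- For distinct sites i and j the distances from i to j and from j to i around the cycle add up to
-- n = 2m + 1, so one of them is at most m: one agent has its partner among its m targets. The agents
-- query alternately, so if that target comes r-th in the agent's random ordering, the execution ends
-- by query 2r; r is uniform on 1, …, m, hence the expected cost is at most m + 1 = (n + 1)/2. For the
-- sites 0 and n − 1 this is attained: site 0 never queries n − 1, while n − 1 queries second in each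
-- round and targets 0 exactly once, so the cost is exactly 2r.

open import Defs
open import Data.Bool using (true; false; if_then_else_; _∧_; _∨_)
open import Data.Bool.Properties using (∨-identityʳ; ∨-comm)
open import Data.Empty using (⊥-elim)
open import Data.Fin using (Fin; toℕ; fromℕ) renaming (zero to fzero)
open import Data.Fin.Properties using (toℕ<n; toℕ-injective; toℕ-fromℕ)
open import Data.Integer using (+_; +≤+)
open import Data.Integer.Properties using (pos-*)
import Data.Integer as ℤ
open import Data.List using (List; []; _∷_; _++_; [_]; map; concatMap; length; upTo; applyUpTo)
open import Data.List.Properties
  using (map-∘; map-cong; map-concatMap; length-++; length-map; length-applyUpTo; concatMap-++;
         concatMap-cong; concatMap-map; ++-identityʳ; upTo-∷ʳ; map-upTo)
open import Data.List.Membership.Propositional using (_∈_; _∉_)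
open import Data.List.Membership.Propositional.Properties using (∈-applyUpTo⁺; ∈-applyUpTo⁻)
open import Data.List.Relation.Binary.Permutation.Propositional
  using (_↭_; ↭-refl; ↭-prep; ↭-swap; ↭-trans; ↭-sym)
open import Data.List.Relation.Binary.Permutation.Propositional.Properties
  using (↭-length; ∈-resp-↭)
open import Data.List.Relation.Unary.All as All using (All; []; _∷_)
import Data.List.Relation.Unary.All.Properties as Allₚ
open import Data.List.Relation.Unary.Any as Any using (here; there)
open import Data.Nat hiding (_/_)
open import Data.Nat.DivMod using (m<n⇒m%n≡m; [m+n]%n≡m%n; m≡m%n+[m/n]*n; m/n≡1+[m∸n]/n)
open import Data.Nat.ListAction using (sum)
open import Data.Nat.ListAction.Properties using (sum-++)
open import Data.Nat.Properties
open import Data.Nat.Tactic.RingSolver using (solve-∀)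
open import Data.Product using (_×_; _,_; proj₁; proj₂; ∃-syntax; swap)
open import Data.Rational using (_/_) renaming (_≤_ to _≤ℚ_)
open import Data.Rational.Properties
  using (toℚᵘ-cancel-≤; toℚᵘ-fromℚᵘ; fromℚᵘ-cong; nonNegative⁻¹; normalize-nonNeg)
import Data.Rational.Unnormalised as ℚᵘ
import Data.Rational.Unnormalised.Properties as ℚᵘ
open import Data.Sum using (_⊎_; inj₁; inj₂) renaming (swap to ⊎-swap)
open import Function using (_∘_)
open import Relation.Binary.Definitions using (tri<; tri≈; tri>)
open import Relation.Binary.PropositionalEquality
  using (_≡_; _≢_; refl; sym; trans; cong; cong₂; subst; subst₂; module ≡-Reasoning)
open import Relation.Nullary using (yes; no)
open import Relation.Nullary.Decidable using (dec-true; dec-false)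

private
  variable
    A B : Set

∑ : List A → (A → ℕ) → ℕ
∑ xs f = sum (map f xs)

syntax ∑ xs (λ x → e) = ∑[ x ∈ xs ] e

sum-concatMap : ∀ (g : A → List ℕ) xs → sum (concatMap g xs) ≡ ∑ xs (sum ∘ g)
sum-concatMap g [] = refl
sum-concatMap g (x ∷ xs) =
  trans (sum-++ (g x) (concatMap g xs)) (cong (_+_ (sum (g x))) (sum-concatMap g xs))

∑-concatMap : ∀ (g : A → List B) xs f → ∑ (concatMap g xs) f ≡ ∑[ x ∈ xs ] ∑ (g x) f
∑-concatMap g xs f =
  trans (cong sum (map-concatMap f g xs)) (sum-concatMap (map f ∘ g) xs)

length-concatMap : ∀ (g : A → List B) xs → length (concatMap g xs) ≡ ∑ xs (length ∘ g)
length-concatMap g [] = refl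
length-concatMap g (x ∷ xs) =
  trans (length-++ (g x)) (cong (_+_ (length (g x))) (length-concatMap g xs))

∑-map : ∀ (g : A → B) xs f → ∑ (map g xs) f ≡ ∑ xs (f ∘ g)
∑-map g xs f = cong sum (sym (map-∘ xs))

∑-cong : ∀ {f g : A → ℕ} → (∀ x → f x ≡ g x) → ∀ xs → ∑ xs f ≡ ∑ xs g
∑-cong f≗g xs = cong sum (map-cong f≗g xs)

∑-cong-All : ∀ {P : A → Set} {f g : A → ℕ} {xs} →
             (∀ {x} → P x → f x ≡ g x) → All P xs → ∑ xs f ≡ ∑ xs g
∑-cong-All f≗g []         = refl
∑-cong-All f≗g (px ∷ pxs) = cong₂ _+_ (f≗g px) (∑-cong-All f≗g pxs)

∑-mono-All : ∀ {P : A → Set} {f g : A → ℕ} {xs} →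
             (∀ {x} → P x → f x ≤ g x) → All P xs → ∑ xs f ≤ ∑ xs g
∑-mono-All f≤g []         = z≤n
∑-mono-All f≤g (px ∷ pxs) = +-mono-≤ (f≤g px) (∑-mono-All f≤g pxs)

∑-const : ∀ (xs : List A) c → ∑ xs (λ _ → c) ≡ length xs * c
∑-const []       c = refl
∑-const (x ∷ xs) c = cong (_+_ c) (∑-const xs c)

∑-+ : ∀ (xs : List A) f g → ∑[ x ∈ xs ] (f x + g x) ≡ ∑ xs f + ∑ xs g
∑-+ []       f g = refl
∑-+ (x ∷ xs) f g =
  trans (cong (_+_ (f x + g x)) (∑-+ xs f g)) (+-assoc-swap (f x) (g x) (∑ xs f) (∑ xs g))
  where
  +-assoc-swap : ∀ a b c d → a + b + (c + d) ≡ a + c + (b + d)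
  +-assoc-swap = solve-∀

∑-*ˡ : ∀ (xs : List A) c f → ∑[ x ∈ xs ] (c * f x) ≡ c * ∑ xs f
∑-*ˡ []       c f = sym (*-zeroʳ c)
∑-*ˡ (x ∷ xs) c f = trans (cong (_+_ (c * f x)) (∑-*ˡ xs c f)) (sym (*-distribˡ-+ c (f x) (∑ xs f)))

∑∑-≤ˡ : ∀ {P : A → Set} {Q : B → Set} {h : A → B → ℕ} {f : A → ℕ} {xs ys} →
        (∀ {x y} → P x → Q y → h x y ≤ f x) → All P xs → All Q ys →
        ∑[ x ∈ xs ] ∑[ y ∈ ys ] h x y ≤ length ys * ∑ xs f
∑∑-≤ˡ {h = h} {f} {xs} {ys} h≤f pxs qys = begin
  ∑[ x ∈ xs ] ∑[ y ∈ ys ] h x y    ≤⟨ ∑-mono-All (λ px → ∑-mono-All (h≤f px) qys) pxs ⟩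
  ∑[ x ∈ xs ] ∑[ y ∈ ys ] f x      ≡⟨ ∑-cong (λ x → ∑-const ys (f x)) xs ⟩
  ∑[ x ∈ xs ] (length ys * f x)    ≡⟨ ∑-*ˡ xs (length ys) f ⟩
  length ys * ∑ xs f               ∎
  where open ≤-Reasoning

∑∑-≤ʳ : ∀ {P : A → Set} {Q : B → Set} {h : A → B → ℕ} {g : B → ℕ} {xs ys} →
        (∀ {x y} → P x → Q y → h x y ≤ g y) → All P xs → All Q ys →
        ∑[ x ∈ xs ] ∑[ y ∈ ys ] h x y ≤ length xs * ∑ ys g
∑∑-≤ʳ {h = h} {g} {xs} {ys} h≤g pxs qys = begin
  ∑[ x ∈ xs ] ∑[ y ∈ ys ] h x y    ≤⟨ ∑-mono-All (λ px → ∑-mono-All (h≤g px) qys) pxs ⟩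
  ∑[ x ∈ xs ] ∑ ys g               ≡⟨ ∑-const xs (∑ ys g) ⟩
  length xs * ∑ ys g               ∎
  where open ≤-Reasoning

applyUpTo-cong : ∀ (f g : ℕ → A) n → (∀ {k} → k < n → f k ≡ g k) → applyUpTo f n ≡ applyUpTo g n
applyUpTo-cong f g zero    f≡g = refl
applyUpTo-cong f g (suc n) f≡g = cong₂ _∷_ (f≡g z<s) (applyUpTo-cong (f ∘ suc) (g ∘ suc) n (f≡g ∘ s<s))

≡ᵇ-refl : ∀ x → (x ≡ᵇ x) ≡ true
≡ᵇ-refl x = dec-true (x ≟ x) refl

≢⇒≡ᵇ-false : ∀ {x y} → x ≢ y → (x ≡ᵇ y) ≡ false
≢⇒≡ᵇ-false {x} {y} = dec-false (x ≟ y)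

-- The 1-based position of the first occurrence of x; it is length ys + 1 when x ∉ ys.
rank : ℕ → List ℕ → ℕ
rank x []       = 1
rank x (y ∷ ys) = if y ≡ᵇ x then 1 else suc (rank x ys)

rank-here : ∀ x ys → rank x (x ∷ ys) ≡ 1
rank-here x ys rewrite ≡ᵇ-refl x = refl

rank-there : ∀ {x y} ys → y ≢ x → rank x (y ∷ ys) ≡ suc (rank x ys)
rank-there ys y≢x rewrite ≢⇒≡ᵇ-false y≢x = refl

insertions-↭ : ∀ y σ → All (_↭ y ∷ σ) (insertions y σ)
insertions-↭ y []       = ↭-refl ∷ []
insertions-↭ y (z ∷ zs) =
  ↭-refl ∷ Allₚ.map⁺ (All.map (λ τ↭ → ↭-trans (↭-prep z τ↭) (↭-swap z y ↭-refl)) (insertions-↭ y zs))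

orderings-↭ : ∀ xs → All (_↭ xs) (orderings xs)
orderings-↭ []       = ↭-refl ∷ []
orderings-↭ (y ∷ xs) = Allₚ.concat⁺ (Allₚ.map⁺ (All.map
  (λ σ↭xs → All.map (λ τ↭ → ↭-trans τ↭ (↭-prep y σ↭xs)) (insertions-↭ y _))
  (orderings-↭ xs)))

length-insertions : ∀ y σ → length (insertions y σ) ≡ suc (length σ)
length-insertions y []       = refl
length-insertions y (z ∷ zs) =
  cong suc (trans (length-map (z ∷_) (insertions y zs)) (length-insertions y zs))

length-orderings : ∀ xs → length (orderings xs) ≡ length xs !
length-orderings []       = refl
length-orderings (y ∷ xs) = begin
  length (concatMap (insertions y) (orderings xs))      ≡⟨ length-concatMap (insertions y) (orderings xs) ⟩
  ∑[ σ ∈ orderings xs ] length (insertions y σ)         ≡⟨ ∑-cong-All length-ins (orderings-↭ xs) ⟩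
  ∑[ σ ∈ orderings xs ] suc (length xs)                 ≡⟨ ∑-const (orderings xs) (suc (length xs)) ⟩
  length (orderings xs) * suc (length xs)               ≡⟨ cong (_* suc (length xs)) (length-orderings xs) ⟩
  length xs ! * suc (length xs)                         ≡⟨ *-comm (length xs !) (suc (length xs)) ⟩
  suc (length xs) !                                     ∎
  where
  open ≡-Reasoning
  length-ins : ∀ {σ} → σ ↭ xs → length (insertions y σ) ≡ suc (length xs)
  length-ins {σ} σ↭xs = trans (length-insertions y σ) (cong suc (↭-length σ↭xs))

∑-orderings-const : ∀ xs c → ∑ (orderings xs) (λ _ → c) ≡ length xs ! * c
∑-orderings-const xs c = trans (∑-const (orderings xs) c) (cong (_* c) (length-orderings xs))

∑-rank-map-cons-here : ∀ x (us : List (List ℕ)) → ∑ (map (x ∷_) us) (rank x) ≡ length us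
∑-rank-map-cons-here x us = begin
  ∑ (map (x ∷_) us) (rank x)           ≡⟨ ∑-map (x ∷_) us (rank x) ⟩
  ∑[ τ ∈ us ] rank x (x ∷ τ)           ≡⟨ ∑-cong (rank-here x) us ⟩
  ∑[ τ ∈ us ] 1                        ≡⟨ ∑-const us 1 ⟩
  length us * 1                        ≡⟨ *-identityʳ (length us) ⟩
  length us                            ∎
  where open ≡-Reasoning

∑-rank-map-cons-there : ∀ {x z} → z ≢ x → ∀ (us : List (List ℕ)) →
                        ∑ (map (z ∷_) us) (rank x) ≡ length us + ∑ us (rank x)
∑-rank-map-cons-there {x} {z} z≢x us = begin
  ∑ (map (z ∷_) us) (rank x)           ≡⟨ ∑-map (z ∷_) us (rank x) ⟩
  ∑[ τ ∈ us ] rank x (z ∷ τ)           ≡⟨ ∑-cong (λ τ → rank-there τ z≢x) us ⟩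
  ∑[ τ ∈ us ] (1 + rank x τ)           ≡⟨ ∑-+ us (λ _ → 1) (rank x) ⟩
  ∑[ τ ∈ us ] 1 + ∑ us (rank x)        ≡⟨ cong (_+ ∑ us (rank x)) (trans (∑-const us 1) (*-identityʳ _)) ⟩
  length us + ∑ us (rank x)            ∎
  where open ≡-Reasoning

∑-rank-insertions : ∀ {x y} → y ≢ x → ∀ σ →
                    ∑ (insertions y σ) (rank x) ≡ (length σ + 2) * rank x σ
∑-rank-insertions {x} y≢x [] rewrite rank-there [] y≢x = refl
∑-rank-insertions {x} {y} y≢x (z ∷ zs) with z ≟ x
... | yes refl = begin
  rank x (y ∷ x ∷ zs) + ∑ (map (x ∷_) (insertions y zs)) (rank x)
    ≡⟨ cong₂ _+_ (trans (rank-there (x ∷ zs) y≢x) (cong suc (rank-here x zs)))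
                 (∑-rank-map-cons-here x (insertions y zs)) ⟩
  2 + length (insertions y zs)                    ≡⟨ cong (_+_ 2) (length-insertions y zs) ⟩
  2 + suc (length zs)                             ≡⟨ trans (+-comm 2 (suc (length zs))) (sym (*-identityʳ _)) ⟩
  (suc (length zs) + 2) * 1                       ≡⟨ cong (_*_ (suc (length zs) + 2)) (rank-here x zs) ⟨
  (suc (length zs) + 2) * rank x (x ∷ zs)         ∎
  where open ≡-Reasoning
... | no z≢x = begin
  rank x (y ∷ z ∷ zs) + ∑ (map (z ∷_) (insertions y zs)) (rank x)
    ≡⟨ cong₂ _+_ (trans (rank-there (z ∷ zs) y≢x) (cong suc (rank-there zs z≢x)))
                 (∑-rank-map-cons-there z≢x (insertions y zs)) ⟩
  suc (suc r) + (length (insertions y zs) + ∑ (insertions y zs) (rank x))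
    ≡⟨ cong₂ (λ a b → suc (suc r) + (a + b)) (length-insertions y zs) (∑-rank-insertions y≢x zs) ⟩
  suc (suc r) + (suc l + (l + 2) * r)             ≡⟨ ring l r ⟩
  (suc l + 2) * suc r                             ≡⟨ cong (_*_ (suc l + 2)) (rank-there zs z≢x) ⟨
  (suc l + 2) * rank x (z ∷ zs)                   ∎
  where
  open ≡-Reasoning
  l = length zs
  r = rank x zs
  ring : ∀ l r → suc (suc r) + (suc l + (l + 2) * r) ≡ (suc l + 2) * suc r
  ring = solve-∀

2*∑-rank-insertions-self-there : ∀ {x z} zs → z ≢ x →
  2 * ∑ (insertions x (z ∷ zs)) (rank x) ≡ 2 * (length zs + 2) + 2 * ∑ (insertions x zs) (rank x)
2*∑-rank-insertions-self-there {x} {z} zs z≢x = begin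
  2 * (rank x (x ∷ z ∷ zs) + ∑ (map (z ∷_) (insertions x zs)) (rank x))
    ≡⟨ cong (_*_ 2) (cong₂ _+_ (rank-here x (z ∷ zs)) (∑-rank-map-cons-there z≢x (insertions x zs))) ⟩
  2 * (1 + (length (insertions x zs) + s))        ≡⟨ cong (λ k → 2 * (1 + (k + s))) (length-insertions x zs) ⟩
  2 * (1 + (suc (length zs) + s))                 ≡⟨ ring (length zs) s ⟩
  2 * (length zs + 2) + 2 * s                     ∎
  where
  open ≡-Reasoning
  s = ∑ (insertions x zs) (rank x)
  ring : ∀ l s → 2 * (1 + (suc l + s)) ≡ 2 * (l + 2) + 2 * s
  ring = solve-∀

triangle-suc : ∀ l → 2 * (l + 2) + (l + 1) * (l + 2) ≡ (suc l + 1) * (suc l + 2)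
triangle-suc = solve-∀

2*∑-rank-insertions-self-≤ : ∀ x σ →
  2 * ∑ (insertions x σ) (rank x) ≤ (length σ + 1) * (length σ + 2)
2*∑-rank-insertions-self-≤ x [] rewrite rank-here x [] = ≤-refl
2*∑-rank-insertions-self-≤ x (z ∷ zs) with z ≟ x
... | yes refl = begin
  2 * (rank x (x ∷ x ∷ zs) + ∑ (map (x ∷_) (insertions x zs)) (rank x))
    ≡⟨ cong (_*_ 2) (cong₂ _+_ (rank-here x (x ∷ zs)) (∑-rank-map-cons-here x (insertions x zs))) ⟩
  2 * (1 + length (insertions x zs))              ≡⟨ cong (λ k → 2 * (1 + k)) (length-insertions x zs) ⟩
  2 * (1 + suc l)                                 ≡⟨ cong (_*_ 2) (+-comm 1 (suc l)) ⟩
  2 * (suc l + 1)                                 ≤⟨ *-monoˡ-≤ (suc l + 1) (m≤n+m 2 (suc l)) ⟩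
  (suc l + 2) * (suc l + 1)                       ≡⟨ *-comm (suc l + 2) (suc l + 1) ⟩
  (suc l + 1) * (suc l + 2)                       ∎
  where
  open ≤-Reasoning
  l = length zs
... | no z≢x = begin
  2 * ∑ (insertions x (z ∷ zs)) (rank x)          ≡⟨ 2*∑-rank-insertions-self-there zs z≢x ⟩
  2 * (l + 2) + 2 * ∑ (insertions x zs) (rank x)  ≤⟨ +-monoʳ-≤ (2 * (l + 2)) (2*∑-rank-insertions-self-≤ x zs) ⟩
  2 * (l + 2) + (l + 1) * (l + 2)                 ≡⟨ triangle-suc l ⟩
  (suc l + 1) * (suc l + 2)                       ∎
  where
  open ≤-Reasoning
  l = length zs

2*∑-rank-insertions-self : ∀ {x} σ → x ∉ σ →
  2 * ∑ (insertions x σ) (rank x) ≡ (length σ + 1) * (length σ + 2)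
2*∑-rank-insertions-self {x} [] x∉σ rewrite rank-here x [] = refl
2*∑-rank-insertions-self {x} (z ∷ zs) x∉σ = begin
  2 * ∑ (insertions x (z ∷ zs)) (rank x)          ≡⟨ 2*∑-rank-insertions-self-there zs (x∉σ ∘ here ∘ sym) ⟩
  2 * (l + 2) + 2 * ∑ (insertions x zs) (rank x)  ≡⟨ cong (_+_ (2 * (l + 2))) (2*∑-rank-insertions-self zs (x∉σ ∘ there)) ⟩
  2 * (l + 2) + (l + 1) * (l + 2)                 ≡⟨ triangle-suc l ⟩
  (suc l + 1) * (suc l + 2)                       ∎
  where
  open ≡-Reasoning
  l = length zs

2*∑-rank-orderings-cons : ∀ x y xs → 2 * ∑ (orderings (y ∷ xs)) (rank x) ≡
                          ∑[ σ ∈ orderings xs ] (2 * ∑ (insertions y σ) (rank x))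
2*∑-rank-orderings-cons x y xs = begin
  2 * ∑ (orderings (y ∷ xs)) (rank x)
    ≡⟨ cong (_*_ 2) (∑-concatMap (insertions y) (orderings xs) (rank x)) ⟩
  2 * ∑[ σ ∈ orderings xs ] ∑ (insertions y σ) (rank x)  ≡⟨ ∑-*ˡ (orderings xs) 2 (λ σ → ∑ (insertions y σ) (rank x)) ⟨
  ∑[ σ ∈ orderings xs ] (2 * ∑ (insertions y σ) (rank x))  ∎
  where open ≡-Reasoning

∑-orderings-triangle : ∀ xs → ∑[ σ ∈ orderings xs ] ((length xs + 1) * (length xs + 2))
                              ≡ suc (suc (length xs)) * suc (length xs) !
∑-orderings-triangle xs =
  trans (∑-orderings-const xs _) (ring (length xs) (length xs !))
  where
  ring : ∀ l f → f * ((l + 1) * (l + 2)) ≡ suc (suc l) * (suc l * f)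
  ring = solve-∀

-- Equality holds when x occurs once in xs; further occurrences can only lower the rank.
2*∑-rank-orderings-≤ : ∀ {x} xs → x ∈ xs → 2 * ∑ (orderings xs) (rank x) ≤ suc (length xs) * length xs !
2*∑-rank-orderings-≤ {x} (y ∷ xs) x∈y∷xs with y ≟ x
... | yes refl = begin
  2 * ∑ (orderings (x ∷ xs)) (rank x)                    ≡⟨ 2*∑-rank-orderings-cons x x xs ⟩
  ∑[ σ ∈ orderings xs ] (2 * ∑ (insertions x σ) (rank x))  ≤⟨ ∑-mono-All bound (orderings-↭ xs) ⟩
  ∑[ σ ∈ orderings xs ] ((l + 1) * (l + 2))              ≡⟨ ∑-orderings-triangle xs ⟩
  suc (suc l) * suc l !                                  ∎
  where
  open ≤-Reasoning
  l = length xs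
  bound : ∀ {σ} → σ ↭ xs → 2 * ∑ (insertions x σ) (rank x) ≤ (l + 1) * (l + 2)
  bound {σ} σ↭xs =
    subst (λ k → 2 * ∑ (insertions x σ) (rank x) ≤ (k + 1) * (k + 2)) (↭-length σ↭xs)
          (2*∑-rank-insertions-self-≤ x σ)
... | no y≢x = begin
  2 * ∑ (orderings (y ∷ xs)) (rank x)                    ≡⟨ 2*∑-rank-orderings-cons x y xs ⟩
  ∑[ σ ∈ orderings xs ] (2 * ∑ (insertions y σ) (rank x))  ≡⟨ ∑-cong-All recurrence (orderings-↭ xs) ⟩
  ∑[ σ ∈ orderings xs ] ((l + 2) * (2 * rank x σ))       ≡⟨ ∑-*ˡ (orderings xs) (l + 2) (λ σ → 2 * rank x σ) ⟩
  (l + 2) * ∑[ σ ∈ orderings xs ] (2 * rank x σ)          ≡⟨ cong (_*_ (l + 2)) (∑-*ˡ (orderings xs) 2 (rank x)) ⟩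
  (l + 2) * (2 * ∑ (orderings xs) (rank x))              ≤⟨ *-monoʳ-≤ (l + 2) (2*∑-rank-orderings-≤ xs x∈xs) ⟩
  (l + 2) * (suc l * l !)                                ≡⟨ cong (_* suc l !) (+-comm l 2) ⟩
  suc (suc l) * suc l !                                  ∎
  where
  open ≤-Reasoning
  l = length xs
  x∈xs : x ∈ xs
  x∈xs = Any.tail (y≢x ∘ sym) x∈y∷xs
  recurrence : ∀ {σ} → σ ↭ xs → 2 * ∑ (insertions y σ) (rank x) ≡ (l + 2) * (2 * rank x σ)
  recurrence {σ} σ↭xs = begin-equality
    2 * ∑ (insertions y σ) (rank x)      ≡⟨ cong (_*_ 2) (∑-rank-insertions y≢x σ) ⟩
    2 * ((length σ + 2) * rank x σ)      ≡⟨ cong (λ k → 2 * ((k + 2) * rank x σ)) (↭-length σ↭xs) ⟩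
    2 * ((l + 2) * rank x σ)             ≡⟨ *-comm-middle 2 (l + 2) (rank x σ) ⟩
    (l + 2) * (2 * rank x σ)             ∎
    where
    *-comm-middle : ∀ a b c → a * (b * c) ≡ b * (a * c)
    *-comm-middle = solve-∀

2*∑-rank-orderings-head : ∀ {x} xs → x ∉ xs →
                          2 * ∑ (orderings (x ∷ xs)) (rank x) ≡ suc (length (x ∷ xs)) * length (x ∷ xs) !
2*∑-rank-orderings-head {x} xs x∉xs = begin
  2 * ∑ (orderings (x ∷ xs)) (rank x)                    ≡⟨ 2*∑-rank-orderings-cons x x xs ⟩
  ∑[ σ ∈ orderings xs ] (2 * ∑ (insertions x σ) (rank x))  ≡⟨ ∑-cong-All uniform (orderings-↭ xs) ⟩
  ∑[ σ ∈ orderings xs ] ((l + 1) * (l + 2))              ≡⟨ ∑-orderings-triangle xs ⟩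
  suc (suc l) * suc l !                                  ∎
  where
  open ≡-Reasoning
  l = length xs
  uniform : ∀ {σ} → σ ↭ xs → 2 * ∑ (insertions x σ) (rank x) ≡ (l + 1) * (l + 2)
  uniform {σ} σ↭xs =
    subst (λ k → 2 * ∑ (insertions x σ) (rank x) ≡ (k + 1) * (k + 2)) (↭-length σ↭xs)
          (2*∑-rank-insertions-self σ (x∉xs ∘ ∈-resp-↭ σ↭xs))

success-comm : ∀ a b q → success a b q ≡ success b a q
success-comm a b (i , t) = ∨-comm ((i ≡ᵇ a) ∧ (t ≡ᵇ b)) ((i ≡ᵇ b) ∧ (t ≡ᵇ a))

costUntil-comm : ∀ a b qs → costUntil a b qs ≡ costUntil b a qs
costUntil-comm a b []       = refl
costUntil-comm a b (q ∷ qs) rewrite success-comm a b q | costUntil-comm a b qs = refl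

success-first : ∀ {p q} t → p ≢ q → success p q (p , t) ≡ (t ≡ᵇ q)
success-first {p} t p≢q rewrite ≡ᵇ-refl p | ≢⇒≡ᵇ-false p≢q = ∨-identityʳ (t ≡ᵇ _)

success-second : ∀ {p q} t → p ≢ q → success p q (q , t) ≡ (t ≡ᵇ p)
success-second {p} {q} t p≢q rewrite ≡ᵇ-refl q | ≢⇒≡ᵇ-false (p≢q ∘ sym) = refl

interleave : ℕ → ℕ → List ℕ → List ℕ → List Query
interleave p q (x ∷ xs) (y ∷ ys) = (p , x) ∷ (q , y) ∷ interleave p q xs ys
interleave p q _        _        = []

costUntil-interleave-first : ∀ {p q} → p ≢ q → ∀ xs ys →
                             costUntil p q (interleave p q xs ys) ≤ 2 * rank q xs
costUntil-interleave-first p≢q []       ys       = z≤n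
costUntil-interleave-first p≢q (x ∷ xs) []       = z≤n
costUntil-interleave-first {p} {q} p≢q (x ∷ xs) (y ∷ ys)
  rewrite success-first x p≢q | success-second y p≢q with x ≡ᵇ q | y ≡ᵇ p
... | true  | _     = s≤s z≤n
... | false | true  rewrite *-suc 2 (rank q xs) = s≤s (s≤s z≤n)
... | false | false rewrite *-suc 2 (rank q xs) = s≤s (s≤s (costUntil-interleave-first p≢q xs ys))

costUntil-interleave-second : ∀ {p q} → p ≢ q → ∀ xs ys →
                              costUntil p q (interleave p q xs ys) ≤ 2 * rank p ys
costUntil-interleave-second p≢q []       ys       = z≤n
costUntil-interleave-second p≢q (x ∷ xs) []       = z≤n
costUntil-interleave-second {p} {q} p≢q (x ∷ xs) (y ∷ ys)
  rewrite success-first x p≢q | success-second y p≢q with x ≡ᵇ q | y ≡ᵇ p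
... | true  | true  = s≤s z≤n
... | true  | false rewrite *-suc 2 (rank p ys) = s≤s z≤n
... | false | true  = ≤-refl
... | false | false rewrite *-suc 2 (rank p ys) = s≤s (s≤s (costUntil-interleave-second p≢q xs ys))

costUntil-interleave-second-exact : ∀ {p q} → p ≢ q → ∀ xs ys → length xs ≡ length ys →
  q ∉ xs → p ∈ ys → costUntil p q (interleave p q xs ys) ≡ 2 * rank p ys
costUntil-interleave-second-exact {p} {q} p≢q (x ∷ xs) (y ∷ ys) |xs|≡|ys| q∉x∷xs p∈y∷ys
  rewrite success-first x p≢q | success-second y p≢q | ≢⇒≡ᵇ-false (q∉x∷xs ∘ here ∘ sym)
  with y ≟ p
... | yes refl rewrite ≡ᵇ-refl y = refl
... | no y≢p rewrite ≢⇒≡ᵇ-false y≢p | *-suc 2 (rank p ys) =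
  cong (suc ∘ suc) (costUntil-interleave-second-exact p≢q xs ys (suc-injective |xs|≡|ys|)
                      (q∉x∷xs ∘ there) (Any.tail (y≢p ∘ sym) p∈y∷ys))

concatMap-upTo-suc : ∀ (g : ℕ → List A) n → concatMap g (upTo (suc n)) ≡ concatMap g (upTo n) ++ g n
concatMap-upTo-suc g n = begin
  concatMap g (upTo (suc n))            ≡⟨ cong (concatMap g) (upTo-∷ʳ n) ⟨
  concatMap g (upTo n ++ [ n ])         ≡⟨ concatMap-++ g (upTo n) [ n ] ⟩
  concatMap g (upTo n) ++ (g n ++ [])   ≡⟨ cong (concatMap g (upTo n) ++_) (++-identityʳ (g n)) ⟩
  concatMap g (upTo n) ++ g n           ∎
  where open ≡-Reasoning

concatMap-upTo-vanishing : ∀ (g : ℕ → List A) {k} n → (∀ {j} → k ≤ j → j < n → g j ≡ []) →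
                           k ≤ n → concatMap g (upTo n) ≡ concatMap g (upTo k)
concatMap-upTo-vanishing g zero    g≡[] z≤n = refl
concatMap-upTo-vanishing g {k} (suc n) g≡[] k≤1+n with m≤n⇒m<n∨m≡n k≤1+n
... | inj₂ refl = refl
... | inj₁ k<1+n = begin
  concatMap g (upTo (suc n))            ≡⟨ concatMap-upTo-suc g n ⟩
  concatMap g (upTo n) ++ g n           ≡⟨ cong (concatMap g (upTo n) ++_) (g≡[] (≤-pred k<1+n) ≤-refl) ⟩
  concatMap g (upTo n) ++ []            ≡⟨ ++-identityʳ _ ⟩
  concatMap g (upTo n)
    ≡⟨ concatMap-upTo-vanishing g n (λ k≤j j<n → g≡[] k≤j (m≤n⇒m≤1+n j<n)) (≤-pred k<1+n) ⟩
  concatMap g (upTo k)                  ∎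
  where open ≡-Reasoning

concatMap-upTo-two-points : ∀ (g : ℕ → List A) {p q n} → p < q → q < n →
                            (∀ {j} → j ≢ p → j ≢ q → g j ≡ []) →
                            concatMap g (upTo n) ≡ g p ++ g q
concatMap-upTo-two-points g {p} {q} {n} p<q q<n g≡[] = begin
  concatMap g (upTo n)                   ≡⟨ concatMap-upTo-vanishing g n above-q q<n ⟩
  concatMap g (upTo (suc q))             ≡⟨ concatMap-upTo-suc g q ⟩
  concatMap g (upTo q) ++ g q            ≡⟨ cong (_++ g q) (concatMap-upTo-vanishing g q between p<q) ⟩
  concatMap g (upTo (suc p)) ++ g q      ≡⟨ cong (_++ g q) (concatMap-upTo-suc g p) ⟩
  (concatMap g (upTo p) ++ g p) ++ g q   ≡⟨ cong (λ xs → (xs ++ g p) ++ g q) (concatMap-upTo-vanishing g p below-p z≤n) ⟩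
  g p ++ g q                             ∎
  where
  open ≡-Reasoning
  above-q : ∀ {j} → q < j → j < n → g j ≡ []
  above-q q<j _ = g≡[] (>⇒≢ (<-trans p<q q<j)) (>⇒≢ q<j)
  between : ∀ {j} → p < j → j < q → g j ≡ []
  between p<j j<q = g≡[] (>⇒≢ p<j) (<⇒≢ j<q)
  below-p : ∀ {j} → 0 ≤ j → j < p → g j ≡ []
  below-p _ j<p = g≡[] (<⇒≢ j<p) (<⇒≢ (<-trans j<p p<q))

roundQueries-ordered : ∀ {n a b} σa σb r → a < b → b < n →
                       roundQueries n a b σa σb r ≡ query a (nth σa r) ++ query b (nth σb r)
roundQueries-ordered {n} {a} {b} σa σb r a<b b<n =
  trans (concatMap-upTo-two-points visit a<b b<n elsewhere) (cong₂ _++_ at-a at-b)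
  where
  visit : ℕ → List Query
  visit j = if j ≡ᵇ a then query a (nth σa r) else if j ≡ᵇ b then query b (nth σb r) else []
  elsewhere : ∀ {j} → j ≢ a → j ≢ b → visit j ≡ []
  elsewhere j≢a j≢b rewrite ≢⇒≡ᵇ-false j≢a | ≢⇒≡ᵇ-false j≢b = refl
  at-a : visit a ≡ query a (nth σa r)
  at-a rewrite ≡ᵇ-refl a = refl
  at-b : visit b ≡ query b (nth σb r)
  at-b rewrite ≢⇒≡ᵇ-false (>⇒≢ a<b) | ≡ᵇ-refl b = refl

concatMap-rounds : ∀ p q xs ys → length xs ≡ length ys →
  concatMap (λ r → query p (nth xs r) ++ query q (nth ys r)) (upTo (length xs)) ≡ interleave p q xs ys
concatMap-rounds p q []       []       _         = refl
concatMap-rounds p q (x ∷ xs) (y ∷ ys) |xs|≡|ys| = cong (λ qs → (p , x) ∷ (q , y) ∷ qs) (begin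
  concatMap round (applyUpTo suc (length xs))   ≡⟨ cong (concatMap round) (map-upTo suc (length xs)) ⟨
  concatMap round (map suc (upTo (length xs)))  ≡⟨ concatMap-map round suc (upTo (length xs)) ⟩
  concatMap (round ∘ suc) (upTo (length xs))    ≡⟨ concatMap-rounds p q xs ys (suc-injective |xs|≡|ys|) ⟩
  interleave p q xs ys                          ∎)
  where
  open ≡-Reasoning
  round : ℕ → List Query
  round r = query p (nth (x ∷ xs) r) ++ query q (nth (y ∷ ys) r)

allQueries-ordered : ∀ {n a b} σa σb → a < b → b < n → length σa ≡ half n → length σb ≡ half n →
                     allQueries n a b σa σb ≡ interleave a b σa σb
allQueries-ordered {n} {a} {b} σa σb a<b b<n |σa|≡m |σb|≡m = begin
  concatMap (roundQueries n a b σa σb) (upTo (half n))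
    ≡⟨ concatMap-cong (λ r → roundQueries-ordered σa σb r a<b b<n) (upTo (half n)) ⟩
  concatMap round (upTo (half n))          ≡⟨ cong (concatMap round ∘ upTo) |σa|≡m ⟨
  concatMap round (upTo (length σa))       ≡⟨ concatMap-rounds a b σa σb (trans |σa|≡m (sym |σb|≡m)) ⟩
  interleave a b σa σb                     ∎
  where
  open ≡-Reasoning
  round : ℕ → List Query
  round r = query a (nth σa r) ++ query b (nth σb r)

allQueries-comm : ∀ n {a b} σa σb → a ≢ b → allQueries n a b σa σb ≡ allQueries n b a σb σa
allQueries-comm n {a} {b} σa σb a≢b =
  concatMap-cong (λ r → concatMap-cong (visit-comm r) (upTo n)) (upTo (half n))
  where
  visit-comm : ∀ r j →
    (if j ≡ᵇ a then query a (nth σa r) else if j ≡ᵇ b then query b (nth σb r) else []) ≡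
    (if j ≡ᵇ b then query b (nth σb r) else if j ≡ᵇ a then query a (nth σa r) else [])
  visit-comm r j with j ≟ a
  ... | yes refl rewrite ≡ᵇ-refl j | ≢⇒≡ᵇ-false a≢b = refl
  ... | no j≢a   rewrite ≢⇒≡ᵇ-false j≢a = refl

cost-comm : ∀ n {a b} σa σb → a ≢ b → cost n a b σa σb ≡ cost n b a σb σa
cost-comm n {a} {b} σa σb a≢b =
  trans (cong (costUntil a b) (allQueries-comm n σa σb a≢b)) (costUntil-comm a b (allQueries n b a σb σa))

cost≤2*rank-ordered : ∀ {n a b} σa σb → a < b → b < n → length σa ≡ half n → length σb ≡ half n →
                      cost n a b σa σb ≤ 2 * rank b σa × cost n a b σa σb ≤ 2 * rank a σb
cost≤2*rank-ordered {n} {a} {b} σa σb a<b b<n |σa|≡m |σb|≡m =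
  subst (λ c → c ≤ 2 * rank b σa × c ≤ 2 * rank a σb)
        (sym (cong (costUntil a b) (allQueries-ordered σa σb a<b b<n |σa|≡m |σb|≡m)))
        (costUntil-interleave-first (<⇒≢ a<b) σa σb , costUntil-interleave-second (<⇒≢ a<b) σa σb)

cost≤2*rank : ∀ {n a b} σa σb → a ≢ b → a < n → b < n → length σa ≡ half n → length σb ≡ half n →
              cost n a b σa σb ≤ 2 * rank b σa × cost n a b σa σb ≤ 2 * rank a σb
cost≤2*rank {n} {a} {b} σa σb a≢b a<n b<n |σa|≡m |σb|≡m with <-cmp a b
... | tri< a<b _ _ = cost≤2*rank-ordered σa σb a<b b<n |σa|≡m |σb|≡m
... | tri≈ _ a≡b _ = ⊥-elim (a≢b a≡b)
... | tri> _ _ b<a = subst (λ c → c ≤ 2 * rank b σa × c ≤ 2 * rank a σb) (sym (cost-comm n σa σb a≢b))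
                           (swap (cost≤2*rank-ordered σb σa b<a a<n |σb|≡m |σa|≡m))

cost≡2*rank-ordered : ∀ {n a b} σa σb → a < b → b < n → length σa ≡ half n → length σb ≡ half n →
                      b ∉ σa → a ∈ σb → cost n a b σa σb ≡ 2 * rank a σb
cost≡2*rank-ordered {n} {a} {b} σa σb a<b b<n |σa|≡m |σb|≡m b∉σa a∈σb =
  trans (cong (costUntil a b) (allQueries-ordered σa σb a<b b<n |σa|≡m |σb|≡m))
        (costUntil-interleave-second-exact (<⇒≢ a<b) σa σb (trans |σa|≡m (sym |σb|≡m)) b∉σa a∈σb)

half-suc-double : ∀ m → half (suc (m + m)) ≡ m
half-suc-double zero    = refl
half-suc-double (suc m) = begin
  half (suc (suc (m + suc m)))   ≡⟨ cong (λ k → half (suc (suc k))) (+-suc m m) ⟩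
  half (suc (suc (suc (m + m)))) ≡⟨ m/n≡1+[m∸n]/n {suc (suc (suc (m + m)))} {2} (s≤s (s≤s z≤n)) ⟩
  suc (half (suc (m + m)))       ≡⟨ cong suc (half-suc-double m) ⟩
  suc m                          ∎
  where open ≡-Reasoning

odd⇒suc-double : ∀ n → n % 2 ≡ 1 → ∃[ m ] n ≡ suc (m + m)
odd⇒suc-double n n-odd =
  half n , trans (m≡m%n+[m/n]*n n 2) (cong₂ _+_ n-odd (m*2≡m+m (half n)))
  where
  m*2≡m+m : ∀ m → m * 2 ≡ m + m
  m*2≡m+m = solve-∀

length-targetSet : ∀ n i → length (targetSet (suc n) i) ≡ half (suc n)
length-targetSet n i = begin
  length (map (λ k → (i + k) % suc n) (map suc (upTo (half (suc n)))))
    ≡⟨ length-map _ (map suc (upTo (half (suc n)))) ⟩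
  length (map suc (upTo (half (suc n))))   ≡⟨ length-map suc (upTo (half (suc n))) ⟩
  length (upTo (half (suc n)))             ≡⟨ length-applyUpTo (λ k → k) (half (suc n)) ⟩
  half (suc n)                             ∎
  where open ≡-Reasoning

costTable : (n i j : ℕ) → List ℕ
costTable n i j = concatMap (λ σi → map (λ σj → cost n i j σi σj) (orderings (targetSet n j)))
                            (orderings (targetSet n i))

sum-costTable : ∀ n i j → sum (costTable n i j) ≡
  ∑[ σi ∈ orderings (targetSet n i) ] ∑[ σj ∈ orderings (targetSet n j) ] cost n i j σi σj
sum-costTable n i j = sum-concatMap _ (orderings (targetSet n i))

length-costTable : ∀ n i j → length (costTable n i j) ≡
  length (orderings (targetSet n i)) * length (orderings (targetSet n j))
length-costTable n i j = begin
  length (costTable n i j)                                           ≡⟨ length-concatMap _ Oᵢ ⟩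
  ∑[ σi ∈ Oᵢ ] length (map (λ σj → cost n i j σi σj) Oⱼ)             ≡⟨ ∑-cong (λ σi → length-map _ Oⱼ) Oᵢ ⟩
  ∑[ σi ∈ Oᵢ ] length Oⱼ                                             ≡⟨ ∑-const Oᵢ (length Oⱼ) ⟩
  length Oᵢ * length Oⱼ                                              ∎
  where
  open ≡-Reasoning
  Oᵢ = orderings (targetSet n i)
  Oⱼ = orderings (targetSet n j)

module _ (m : ℕ) where

  private
    n : ℕ
    n = suc (m + m)

  targetSet-applyUpTo : ∀ i → targetSet n i ≡ applyUpTo (λ k → (i + suc k) % n) m
  targetSet-applyUpTo i = begin
    map (λ k → (i + k) % n) (map suc (upTo (half n)))   ≡⟨ map-∘ (upTo (half n)) ⟨
    map (λ k → (i + suc k) % n) (upTo (half n))         ≡⟨ map-upTo (λ k → (i + suc k) % n) (half n) ⟩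
    applyUpTo (λ k → (i + suc k) % n) (half n)          ≡⟨ cong (applyUpTo _) (half-suc-double m) ⟩
    applyUpTo (λ k → (i + suc k) % n) m                 ∎
    where open ≡-Reasoning

  ∈-targetSet : ∀ i {k} → k < m → (i + suc k) % n ∈ targetSet n i
  ∈-targetSet i k<m =
    subst ((i + suc _) % n ∈_) (sym (targetSet-applyUpTo i)) (∈-applyUpTo⁺ (λ k → (i + suc k) % n) k<m)

  -- Going around the cycle from i, site j is reached after j ∸ i steps, and i after n ∸ (j ∸ i);
  -- one of the two distances is at most m.
  targetSet-ordered-pair : ∀ {i j} → i < j → j < n → j ∈ targetSet n i ⊎ i ∈ targetSet n j
  targetSet-ordered-pair {i} i<j j<n with d , refl ← m≤n⇒∃[o]m+o≡n i<j with <-≤-connex d m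
  ... | inj₁ d<m = inj₁ (subst (_∈ targetSet n i) i+1+d%n≡j (∈-targetSet i d<m))
    where
    i+1+d%n≡j : (i + suc d) % n ≡ suc (i + d)
    i+1+d%n≡j = trans (cong (_% n) (+-suc i d)) (m<n⇒m%n≡m j<n)
  ... | inj₂ m≤d
    with k , 1+d+k≡m+m ← m≤n⇒∃[o]m+o≡n (m+n≤o⇒n≤o i (subst (_≤ m + m) (sym (+-suc i d)) (≤-pred j<n)))
    = inj₂ (subst (_∈ targetSet n (suc (i + d))) j+1+k%n≡i (∈-targetSet (suc (i + d)) k<m))
    where
    k<m : k < m
    k<m = +-cancelˡ-≤ m (suc k) m (begin
      m + suc k    ≡⟨ +-suc m k ⟩
      suc m + k    ≤⟨ +-monoˡ-≤ k (s≤s m≤d) ⟩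
      suc d + k    ≡⟨ 1+d+k≡m+m ⟩
      m + m        ∎)
      where open ≤-Reasoning
    j+1+k%n≡i : (suc (i + d) + suc k) % n ≡ i
    j+1+k%n≡i = begin-equality
      (suc (i + d) + suc k) % n     ≡⟨ cong (_% n) (rearrange i d k) ⟩
      (i + suc (suc d + k)) % n     ≡⟨ cong (λ x → (i + suc x) % n) 1+d+k≡m+m ⟩
      (i + n) % n                   ≡⟨ [m+n]%n≡m%n i n ⟩
      i % n                         ≡⟨ m<n⇒m%n≡m (<-trans i<j j<n) ⟩
      i                             ∎
      where
      open ≤-Reasoning
      rearrange : ∀ i d k → suc (i + d) + suc k ≡ i + suc (suc d + k)
      rearrange = solve-∀

  targetSet-pair : ∀ {i j} → i ≢ j → i < n → j < n → j ∈ targetSet n i ⊎ i ∈ targetSet n j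
  targetSet-pair {i} {j} i≢j i<n j<n with <-cmp i j
  ... | tri< i<j _ _ = targetSet-ordered-pair i<j j<n
  ... | tri≈ _ i≡j _ = ⊥-elim (i≢j i≡j)
  ... | tri> _ _ j<i = ⊎-swap (targetSet-ordered-pair j<i i<n)

  targetSet-first : targetSet n 0 ≡ applyUpTo suc m
  targetSet-first = trans (targetSet-applyUpTo 0) (applyUpTo-cong _ suc m (λ k<m → m<n⇒m%n≡m (1+k<n k<m)))
    where
    1+k<n : ∀ {k} → k < m → suc k < n
    1+k<n k<m = s≤s (<-≤-trans k<m (m≤m+n m m))

  targetSet-last : targetSet n (m + m) ≡ upTo m
  targetSet-last = trans (targetSet-applyUpTo (m + m)) (applyUpTo-cong _ (λ k → k) m last≡)
    where
    last≡ : ∀ {k} → k < m → (m + m + suc k) % n ≡ k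
    last≡ {k} k<m = begin
      (m + m + suc k) % n   ≡⟨ cong (_% n) (+-comm (m + m) (suc k)) ⟩
      suc (k + (m + m)) % n ≡⟨ cong (_% n) (+-suc k (m + m)) ⟨
      (k + n) % n           ≡⟨ [m+n]%n≡m%n k n ⟩
      k % n                 ≡⟨ m<n⇒m%n≡m (s≤s (<⇒≤ (<-≤-trans k<m (m≤m+n m m)))) ⟩
      k                     ∎
      where open ≡-Reasoning

  ↭-targetSet-length : ∀ {σ i} → σ ↭ targetSet n i → length σ ≡ half n
  ↭-targetSet-length {i = i} σ↭ = trans (↭-length σ↭) (length-targetSet (m + m) i)

  length-orderings-targetSet : ∀ i → length (orderings (targetSet n i)) ≡ m !
  length-orderings-targetSet i =
    trans (length-orderings (targetSet n i)) (cong _! (trans (length-targetSet (m + m) i) (half-suc-double m)))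

  suc-m*length-costTable : ∀ i j → suc m * length (costTable n i j) ≡ m ! * (suc m * m !)
  suc-m*length-costTable i j = begin
    suc m * length (costTable n i j)   ≡⟨ cong (suc m *_) (length-costTable n i j) ⟩
    suc m * (length Oᵢ * length Oⱼ)
      ≡⟨ cong₂ (λ a b → suc m * (a * b)) (length-orderings-targetSet i) (length-orderings-targetSet j) ⟩
    suc m * (m ! * m !)                ≡⟨ ring (suc m) (m !) ⟩
    m ! * (suc m * m !)                ∎
    where
    open ≡-Reasoning
    Oᵢ = orderings (targetSet n i)
    Oⱼ = orderings (targetSet n j)
    ring : ∀ a f → a * (f * f) ≡ f * (a * f)
    ring = solve-∀

  ∑-2*rank-≤ : ∀ {x} i → x ∈ targetSet n i → ∑[ σ ∈ orderings (targetSet n i) ] (2 * rank x σ) ≤ suc m * m !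
  ∑-2*rank-≤ {x} i x∈S = begin
    ∑[ σ ∈ orderings S ] (2 * rank x σ)     ≡⟨ ∑-*ˡ (orderings S) 2 (rank x) ⟩
    2 * ∑ (orderings S) (rank x)            ≤⟨ 2*∑-rank-orderings-≤ S x∈S ⟩
    suc (length S) * length S !
      ≡⟨ cong (λ l → suc l * l !) (trans (length-targetSet (m + m) i) (half-suc-double m)) ⟩
    suc m * m !                             ∎
    where
    open ≤-Reasoning
    S = targetSet n i

  cost≤2*rank-targets : ∀ {i j σi σj} → i ≢ j → i < n → j < n → σi ↭ targetSet n i → σj ↭ targetSet n j →
                        cost n i j σi σj ≤ 2 * rank j σi × cost n i j σi σj ≤ 2 * rank i σj
  cost≤2*rank-targets {i} {j} {σi} {σj} i≢j i<n j<n σi↭ σj↭ =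
    cost≤2*rank σi σj i≢j i<n j<n (↭-targetSet-length {i = i} σi↭) (↭-targetSet-length {i = j} σj↭)

  ∑-costTable-≤ : ∀ {i j} → i ≢ j → i < n → j < n → sum (costTable n i j) ≤ suc m * length (costTable n i j)
  ∑-costTable-≤ {i} {j} i≢j i<n j<n with targetSet-pair i≢j i<n j<n
  ... | inj₁ j∈Sᵢ = begin
    sum (costTable n i j)                          ≡⟨ sum-costTable n i j ⟩
    ∑[ σi ∈ Oᵢ ] ∑[ σj ∈ Oⱼ ] cost n i j σi σj
      ≤⟨ ∑∑-≤ˡ (λ σi↭ σj↭ → proj₁ (cost≤2*rank-targets i≢j i<n j<n σi↭ σj↭))
               (orderings-↭ (targetSet n i)) (orderings-↭ (targetSet n j)) ⟩
    length Oⱼ * ∑[ σi ∈ Oᵢ ] (2 * rank j σi)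
      ≤⟨ *-mono-≤ (≤-reflexive (length-orderings-targetSet j)) (∑-2*rank-≤ i j∈Sᵢ) ⟩
    m ! * (suc m * m !)                            ≡⟨ suc-m*length-costTable i j ⟨
    suc m * length (costTable n i j)               ∎
    where
    open ≤-Reasoning
    Oᵢ = orderings (targetSet n i)
    Oⱼ = orderings (targetSet n j)
  ... | inj₂ i∈Sⱼ = begin
    sum (costTable n i j)                          ≡⟨ sum-costTable n i j ⟩
    ∑[ σi ∈ Oᵢ ] ∑[ σj ∈ Oⱼ ] cost n i j σi σj
      ≤⟨ ∑∑-≤ʳ (λ σi↭ σj↭ → proj₂ (cost≤2*rank-targets i≢j i<n j<n σi↭ σj↭))
               (orderings-↭ (targetSet n i)) (orderings-↭ (targetSet n j)) ⟩
    length Oᵢ * ∑[ σj ∈ Oⱼ ] (2 * rank i σj)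
      ≤⟨ *-mono-≤ (≤-reflexive (length-orderings-targetSet i)) (∑-2*rank-≤ j i∈Sⱼ) ⟩
    m ! * (suc m * m !)                            ≡⟨ suc-m*length-costTable i j ⟨
    suc m * length (costTable n i j)               ∎
    where
    open ≤-Reasoning
    Oᵢ = orderings (targetSet n i)
    Oⱼ = orderings (targetSet n j)

module _ (m′ : ℕ) where

  private
    m n : ℕ
    m = suc m′
    n = suc (m + m)

  last∉targetSet-first : m + m ∉ targetSet n 0
  last∉targetSet-first m+m∈S₀
    with k , k<m , m+m≡1+k ← ∈-applyUpTo⁻ suc (subst (m + m ∈_) (targetSet-first m) m+m∈S₀) =
    m+1+n≰m m (subst (_≤ m) (sym m+m≡1+k) k<m)

  0∈targetSet-last : 0 ∈ targetSet n (m + m)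
  0∈targetSet-last = subst (0 ∈_) (sym (targetSet-last m)) (here refl)

  -- The target set of the last site is 0, 1, …, m − 1, so site 0 occurs in it exactly once.
  ∑-2*rank-last : ∑[ σ ∈ orderings (targetSet n (m + m)) ] (2 * rank 0 σ) ≡ suc m * m !
  ∑-2*rank-last = begin
    ∑[ σ ∈ orderings (targetSet n (m + m)) ] (2 * rank 0 σ)   ≡⟨ ∑-*ˡ (orderings (targetSet n (m + m))) 2 (rank 0) ⟩
    2 * ∑ (orderings (targetSet n (m + m))) (rank 0)
      ≡⟨ cong (λ L → 2 * ∑ (orderings L) (rank 0)) (targetSet-last m) ⟩
    2 * ∑ (orderings (0 ∷ rest)) (rank 0)                      ≡⟨ 2*∑-rank-orderings-head rest 0∉rest ⟩
    suc (suc (length rest)) * suc (length rest) !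
      ≡⟨ cong (λ l → suc (suc l) * suc l !) (length-applyUpTo suc m′) ⟩
    suc m * m !                                                ∎
    where
    open ≡-Reasoning
    rest = applyUpTo suc m′
    0∉rest : 0 ∉ rest
    0∉rest 0∈rest with _ , _ , () ← ∈-applyUpTo⁻ suc 0∈rest

  ∑-costTable-last : sum (costTable n 0 (m + m)) ≡ suc m * length (costTable n 0 (m + m))
  ∑-costTable-last = begin
    sum (costTable n 0 (m + m))                        ≡⟨ sum-costTable n 0 (m + m) ⟩
    ∑[ σ₀ ∈ O₀ ] ∑[ σₗ ∈ Oₗ ] cost n 0 (m + m) σ₀ σₗ
      ≡⟨ ∑-cong-All (λ σ₀↭ → ∑-cong-All (cost≡ σ₀↭) (orderings-↭ _)) (orderings-↭ _) ⟩
    ∑[ σ₀ ∈ O₀ ] ∑[ σₗ ∈ Oₗ ] (2 * rank 0 σₗ)          ≡⟨ ∑-const O₀ (∑[ σₗ ∈ Oₗ ] (2 * rank 0 σₗ)) ⟩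
    length O₀ * ∑[ σₗ ∈ Oₗ ] (2 * rank 0 σₗ)            ≡⟨ cong₂ _*_ (length-orderings-targetSet m 0) ∑-2*rank-last ⟩
    m ! * (suc m * m !)                                 ≡⟨ suc-m*length-costTable m 0 (m + m) ⟨
    suc m * length (costTable n 0 (m + m))              ∎
    where
    open ≡-Reasoning
    O₀ = orderings (targetSet n 0)
    Oₗ = orderings (targetSet n (m + m))
    cost≡ : ∀ {σ₀ σₗ} → σ₀ ↭ targetSet n 0 → σₗ ↭ targetSet n (m + m) → cost n 0 (m + m) σ₀ σₗ ≡ 2 * rank 0 σₗ
    cost≡ {σ₀} {σₗ} σ₀↭ σₗ↭ =
      cost≡2*rank-ordered σ₀ σₗ z<s ≤-refl (↭-targetSet-length m {i = 0} σ₀↭) (↭-targetSet-length m {i = m + m} σₗ↭)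
        (last∉targetSet-first ∘ ∈-resp-↭ σ₀↭) (∈-resp-↭ (↭-sym σₗ↭) 0∈targetSet-last)

  0<length-costTable-last : 0 < length (costTable n 0 (m + m))
  0<length-costTable-last = subst (0 <_) (sym (trans (length-costTable n 0 (m + m))
    (cong₂ _*_ (length-orderings-targetSet m 0) (length-orderings-targetSet m (m + m)))))
    (*-mono-≤ (1≤n! m) (1≤n! m))

+/-mono-≤ : ∀ {s t d e} → s * suc e ≤ t * suc d → (+ s) / suc d ≤ℚ (+ t) / suc e
+/-mono-≤ {s} {t} {d} {e} s*e≤t*d = toℚᵘ-cancel-≤
  (ℚᵘ.≤-respˡ-≃ (ℚᵘ.≃-sym (toℚᵘ-fromℚᵘ (ℚᵘ.mkℚᵘ (+ s) d)))
  (ℚᵘ.≤-respʳ-≃ (ℚᵘ.≃-sym (toℚᵘ-fromℚᵘ (ℚᵘ.mkℚᵘ (+ t) e)))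
    (ℚᵘ.*≤* (subst₂ ℤ._≤_ (pos-* s (suc e)) (pos-* t (suc d)) (+≤+ s*e≤t*d)))))

+/-cong : ∀ {s t d e} → s * suc e ≡ t * suc d → (+ s) / suc d ≡ (+ t) / suc e
+/-cong {s} {t} {d} {e} s*e≡t*d = fromℚᵘ-cong {ℚᵘ.mkℚᵘ (+ s) d} {ℚᵘ.mkℚᵘ (+ t) e}
  (ℚᵘ.*≡* (trans (sym (pos-* s (suc e))) (trans (cong +_ s*e≡t*d) (pos-* t (suc d)))))

average-≤ : ∀ xs {p q} → sum xs * suc q ≤ p * length xs → average xs ≤ℚ (+ p) / suc q
average-≤ []       {p} {q} _ = nonNegative⁻¹ ((+ p) / suc q) {{normalize-nonNeg p (suc q)}}
average-≤ (x ∷ xs) {p} {q} h = +/-mono-≤ {sum (x ∷ xs)} {p} {length xs} {q} h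

average-≡ : ∀ xs {p q} → 0 < length xs → sum xs * suc q ≡ p * length xs → average xs ≡ (+ p) / suc q
average-≡ (x ∷ xs) {p} {q} _ h = +/-cong {sum (x ∷ xs)} {p} {length xs} {q} h

suc-m*l*2 : ∀ m l → suc m * l * 2 ≡ (suc (m + m) + 1) * l
suc-m*l*2 = solve-∀

average-≤-1+m : ∀ m xs → sum xs ≤ suc m * length xs → average xs ≤ℚ (+ (suc (m + m) + 1)) / 2
average-≤-1+m m xs h = average-≤ xs {suc (m + m) + 1} {1} (begin
  sum xs * 2                    ≤⟨ *-monoˡ-≤ 2 h ⟩
  suc m * length xs * 2         ≡⟨ suc-m*l*2 m (length xs) ⟩
  (suc (m + m) + 1) * length xs ∎)
  where open ≤-Reasoning

average-≡-1+m : ∀ m xs → 0 < length xs → sum xs ≡ suc m * length xs → average xs ≡ (+ (suc (m + m) + 1)) / 2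
average-≡-1+m m xs 0<|xs| h = average-≡ xs {suc (m + m) + 1} {1} 0<|xs| (begin
  sum xs * 2                    ≡⟨ cong (_* 2) h ⟩
  suc m * length xs * 2         ≡⟨ suc-m*l*2 m (length xs) ⟩
  (suc (m + m) + 1) * length xs ∎)
  where open ≡-Reasoning

theorem4 : (n : ℕ) → 3 ≤ n → n % 2 ≡ 1 →
    ((a b : Fin n) → a ≢ b → expectedCost n a b ≤ℚ (+ (n + 1)) / 2)
    × (∃[ a ] ∃[ b ] (a ≢ b × expectedCost n a b ≡ (+ (n + 1)) / 2))
theorem4 n 3≤n n-odd with odd⇒suc-double n n-odd
... | zero   , refl with s≤s () ← 3≤n
... | suc m′ , refl = upper , fzero , fromℕ (m + m) , (λ ()) , exact
  where
  m = suc m′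
  upper : (a b : Fin n) → a ≢ b → expectedCost n a b ≤ℚ (+ (n + 1)) / 2
  upper a b a≢b = average-≤-1+m m (costTable n (toℕ a) (toℕ b))
    (∑-costTable-≤ m (a≢b ∘ toℕ-injective) (toℕ<n a) (toℕ<n b))
  exact : expectedCost n fzero (fromℕ (m + m)) ≡ (+ (n + 1)) / 2
  exact = subst (λ j → average (costTable n 0 j) ≡ (+ (n + 1)) / 2) (sym (toℕ-fromℕ (m + m)))
    (average-≡-1+m m (costTable n 0 (m + m)) (0<length-costTable-last m′) (∑-costTable-last m′))
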